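{- Let $L$ be a symmetric Latin square of order $n$ and let $P$ be its group of principal autotopisms. Then $P$ is abelian. Moreover, if $(\alpha,\beta,\varepsilon)\in P$, then $\beta=\alpha^{ -1}$ and the order of $\alpha$ divides $n$.
   Context: A Latin square of order $n$ is a set of $n^2$ triples (row, column, symbol) over $\{1,\dots,n\}$, distinct triples agreeing in at most one coordinate; it is symmetric if it equals its transpose. An isotopism $(\alpha,\beta,\gamma)\in\mathcal{S}_n^3$ maps $(r,c,s)$ to $(r^\alpha,c^\beta,s^\gamma)$; an autotopism of $L$ is an isotopism mapping $L$ to itself; it is principal if $\gamma=\varepsilon$, the identity permutation. -}

module Defs where

open import Data.Nat using (ℕ; zero; suc; _<_)
open import Data.Fin using (Fin)
open import Data.Fin.Permutation using (Permutation′; _⟨$⟩ʳ_; _⟨$⟩ˡ_; _∘ₚ_; id)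
open import Data.Product using (_×_)
open import Relation.Nullary using (¬_)
open import Relation.Binary.PropositionalEquality using (_≡_)

-- A Latin square of order n, given as its row/column → symbol function:
-- the set of triples is { (r , c , L r c) }.  The Latin condition
-- (distinct triples agree in at most one coordinate) says exactly that
-- each row and each column map is injective.
record LatinSquare (n : ℕ) : Set where
  field
    sym     : Fin n → Fin n → Fin n
    row-inj : ∀ r {c c′} → sym r c ≡ sym r c′ → c ≡ c′
    col-inj : ∀ c {r r′} → sym r c ≡ sym r′ c → r ≡ r′
open LatinSquare public

Symmetric : ∀ {n} → LatinSquare n → Set
Symmetric L = ∀ r c → sym L r c ≡ sym L c r

_≈ₚ_ : ∀ {n} → Permutation′ n → Permutation′ n → Set
π ≈ₚ ρ = ∀ i → π ⟨$⟩ʳ i ≡ ρ ⟨$⟩ʳ i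

-- (α , β , γ) is an autotopism of L: it maps the triple (r , c , L r c)
-- to (r^α , c^β , (L r c)^γ), which must again be a triple of L.
IsAutotopism : ∀ {n} → LatinSquare n →
               Permutation′ n → Permutation′ n → Permutation′ n → Set
IsAutotopism L α β γ =
  ∀ r c → sym L (α ⟨$⟩ʳ r) (β ⟨$⟩ʳ c) ≡ γ ⟨$⟩ʳ (sym L r c)

IsPrincipalAutotopism : ∀ {n} → LatinSquare n →
                        Permutation′ n → Permutation′ n → Set
IsPrincipalAutotopism L α β = IsAutotopism L α β id

_^ₚ_ : ∀ {n} → Permutation′ n → ℕ → Permutation′ n
π ^ₚ zero  = id
π ^ₚ suc k = π ∘ₚ (π ^ₚ k)

IsOrder : ∀ {n} → Permutation′ n → ℕ → Set
IsOrder π k = 0 < k × (π ^ₚ k) ≈ₚ id × (∀ j → 0 < j → j < k → ¬ ((π ^ₚ j) ≈ₚ id))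

-- Evaluating a principal autotopism (α, β, ε) at the cell (r, αr) and using
-- symmetry gives L(αr, β(αr)) = L(r, αr) = L(αr, r), so β(αr) = r by row
-- injectivity: β = α⁻¹, and therefore L(αr, c) = L(r, αc), i.e. α is
-- self-adjoint for L.  Two self-adjoint permutations commute, by column
-- injectivity applied to L(α′αc, c) = L(αc, α′c) = L(α′c, αc) = L(αα′c, c).
-- Self-adjointness also makes α semiregular: if αᵈ fixes one point r then
-- L(r, αᵈc) = L(r, c) for every c, so αᵈ = ε.  Hence every orbit of α has
-- exactly ord(α) points, and ord(α) divides n.
module Submission where

open import Defs
open import Data.Nat using (ℕ; zero; suc; _+_; _∸_; _<_; s≤s)
open import Data.Nat.Properties
  using (+-comm; ≤-refl; <-trans; ≤-<-trans; n<1+n; m≤n+m; m∸n≤m; m<n⇒0<n∸m; m+[n∸m]≡n; <⇒≤)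
open import Data.Nat.Divisibility using (_∣_; _∣0; ∣-refl; ∣m∣n⇒∣m+n)
open import Data.Nat.Induction using (<-wellFounded)
open import Data.Fin using (Fin)
import Data.Fin.Properties as Fin
open import Data.Fin.Permutation
  using (Permutation′; flip; _∘ₚ_; _⟨$⟩ʳ_; _⟨$⟩ˡ_; inverseʳ; id)
open import Data.Product using (_×_; _,_; proj₁; proj₂)
open import Data.Sum using (inj₁; inj₂)
open import Data.List using (List; []; _∷_; _++_; length; applyUpTo; filter; allFin)
open import Data.List.Properties using (length-++; length-applyUpTo; length-tabulate)
open import Data.List.Relation.Unary.Any using (here)
open import Data.List.Relation.Unary.Unique.Propositional using (Unique)
import Data.List.Relation.Unary.Unique.Propositional.Properties as Unique
open import Data.List.Membership.Propositional using (_∈_; _∉_)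
open import Data.List.Membership.Propositional.Properties
  using (∈-applyUpTo⁺; ∈-applyUpTo⁻; ∈-filter⁺; ∈-filter⁻; ∈-++⁺ˡ; ∈-++⁺ʳ; ∈-++⁻; ∈-allFin)
open import Data.List.Membership.Propositional.Properties.WithK using (unique∧set⇒bag)
import Data.List.Membership.DecPropositional as DecMembership
open import Data.List.Relation.Binary.BagAndSetEquality using (∼bag⇒↭)
open import Data.List.Relation.Binary.Permutation.Propositional using (_↭_)
open import Data.List.Relation.Binary.Permutation.Propositional.Properties using (↭-length)
open import Function.Bundles using (_⇔_; mk⇔; Injection)
open import Function.Properties.Inverse using (↔⇒↣)
open import Induction.WellFounded using (Acc; acc)
open import Relation.Nullary using (Dec; yes; no; ¬?)
import Relation.Binary.PropositionalEquality as ≡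
open ≡ using (_≡_; _≢_; refl; trans; cong; subst; module ≡-Reasoning)

⟨$⟩ʳ-injective : ∀ {n} (π : Permutation′ n) {x y} → π ⟨$⟩ʳ x ≡ π ⟨$⟩ʳ y → x ≡ y
⟨$⟩ʳ-injective π = Injection.injective (↔⇒↣ π)

^ₚ-+ : ∀ {n} (π : Permutation′ n) a b x →
       (π ^ₚ (a + b)) ⟨$⟩ʳ x ≡ (π ^ₚ b) ⟨$⟩ʳ ((π ^ₚ a) ⟨$⟩ʳ x)
^ₚ-+ π zero    b x = refl
^ₚ-+ π (suc a) b x = ^ₚ-+ π a b (π ⟨$⟩ʳ x)

^ₚ-suc : ∀ {n} (π : Permutation′ n) j x →
         (π ^ₚ suc j) ⟨$⟩ʳ x ≡ π ⟨$⟩ʳ ((π ^ₚ j) ⟨$⟩ʳ x)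
^ₚ-suc π j x = trans (cong (λ i → (π ^ₚ i) ⟨$⟩ʳ x) (+-comm 1 j)) (^ₚ-+ π j 1 x)

module Semiregular {n m : ℕ} (α : Permutation′ n)
  (α^order≈id : (α ^ₚ suc m) ≈ₚ id)
  (fixed-point-free : ∀ d x → 0 < d → d < suc m → (α ^ₚ d) ⟨$⟩ʳ x ≢ x) where

  open DecMembership (Fin._≟_ {n}) using (_∈?_)

  Closed : List (Fin n) → Set
  Closed S = ∀ {y} → y ∈ S → α ⟨$⟩ʳ y ∈ S

  orbit : Fin n → List (Fin n)
  orbit x = applyUpTo (λ j → (α ^ₚ j) ⟨$⟩ʳ x) (suc m)

  orbit-unique : ∀ x → Unique (orbit x)
  orbit-unique x = Unique.applyUpTo⁺₁ (λ j → (α ^ₚ j) ⟨$⟩ʳ x) (suc m) distinct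
    where
    distinct : ∀ {i j} → i < j → j < suc m → (α ^ₚ i) ⟨$⟩ʳ x ≢ (α ^ₚ j) ⟨$⟩ʳ x
    distinct {i} {j} i<j j<k αⁱx≡αʲx =
      fixed-point-free (j ∸ i) ((α ^ₚ i) ⟨$⟩ʳ x) (m<n⇒0<n∸m i<j) (≤-<-trans (m∸n≤m j i) j<k)
        (begin
          (α ^ₚ (j ∸ i)) ⟨$⟩ʳ ((α ^ₚ i) ⟨$⟩ʳ x) ≡⟨ ≡.sym (^ₚ-+ α i (j ∸ i) x) ⟩
          (α ^ₚ (i + (j ∸ i))) ⟨$⟩ʳ x           ≡⟨ cong (λ d → (α ^ₚ d) ⟨$⟩ʳ x) (m+[n∸m]≡n (<⇒≤ i<j)) ⟩
          (α ^ₚ j) ⟨$⟩ʳ x                       ≡⟨ ≡.sym αⁱx≡αʲx ⟩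
          (α ^ₚ i) ⟨$⟩ʳ x                       ∎)
      where open ≡-Reasoning

  ^ₚ-∈-closed : ∀ {S} → Closed S → ∀ {x} → x ∈ S → ∀ j → (α ^ₚ j) ⟨$⟩ʳ x ∈ S
  ^ₚ-∈-closed closed x∈S zero    = x∈S
  ^ₚ-∈-closed closed {x} x∈S (suc j) =
    subst (_∈ _) (≡.sym (^ₚ-suc α j x)) (closed (^ₚ-∈-closed closed x∈S j))

  orbit-⊆-closed : ∀ {S} → Closed S → ∀ {x} → x ∈ S → ∀ {y} → y ∈ orbit x → y ∈ S
  orbit-⊆-closed closed {x} x∈S y∈orbit with ∈-applyUpTo⁻ (λ j → (α ^ₚ j) ⟨$⟩ʳ x) y∈orbit
  ... | j , _ , refl = ^ₚ-∈-closed closed x∈S j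

  ∉-orbit-closed : ∀ x {y} → y ∉ orbit x → α ⟨$⟩ʳ y ∉ orbit x
  ∉-orbit-closed x {y} y∉orbit αy∈orbit with ∈-applyUpTo⁻ (λ j → (α ^ₚ j) ⟨$⟩ʳ x) αy∈orbit
  ... | zero , _ , αy≡x =
    y∉orbit (subst (_∈ orbit x) (≡.sym (⟨$⟩ʳ-injective α αy≡αᵐx)) (∈-applyUpTo⁺ (λ j → (α ^ₚ j) ⟨$⟩ʳ x) ≤-refl))
    where
    αy≡αᵐx : α ⟨$⟩ʳ y ≡ α ⟨$⟩ʳ ((α ^ₚ m) ⟨$⟩ʳ x)
    αy≡αᵐx = trans αy≡x (trans (≡.sym (α^order≈id x)) (^ₚ-suc α m x))
  ... | suc j , j<k , αy≡αʲ⁺¹x =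
    y∉orbit (subst (_∈ orbit x) (≡.sym (⟨$⟩ʳ-injective α (trans αy≡αʲ⁺¹x (^ₚ-suc α j x))))
                   (∈-applyUpTo⁺ (λ j → (α ^ₚ j) ⟨$⟩ʳ x) (<-trans (n<1+n j) j<k)))

  outside-orbit? : ∀ x y → Dec (y ∉ orbit x)
  outside-orbit? x y = ¬? (y ∈? orbit x)

  outside-orbit : Fin n → List (Fin n) → List (Fin n)
  outside-orbit x = filter (outside-orbit? x)

  ∈-outside-orbit⁻ : ∀ x {S y} → y ∈ outside-orbit x S → y ∈ S × y ∉ orbit x
  ∈-outside-orbit⁻ x {S} = ∈-filter⁻ (outside-orbit? x) {xs = S}

  outside-orbit-unique : ∀ x {S} → Unique S → Unique (outside-orbit x S)
  outside-orbit-unique x = Unique.filter⁺ (outside-orbit? x)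

  outside-orbit-closed : ∀ x {S} → Closed S → Closed (outside-orbit x S)
  outside-orbit-closed x {S} closed y∈rest with ∈-outside-orbit⁻ x {S} y∈rest
  ... | y∈S , y∉orbit = ∈-filter⁺ (outside-orbit? x) (closed y∈S) (∉-orbit-closed x y∉orbit)

  orbit-++-outside-orbit : ∀ {S} → Closed S → ∀ {x} → x ∈ S →
    ∀ {y} → y ∈ S ⇔ y ∈ orbit x ++ outside-orbit x S
  orbit-++-outside-orbit {S} closed {x} x∈S {y} = mk⇔ to from
    where
    to : y ∈ S → y ∈ orbit x ++ outside-orbit x S
    to y∈S with y ∈? orbit x
    ... | yes y∈orbit = ∈-++⁺ˡ y∈orbit
    ... | no  y∉orbit = ∈-++⁺ʳ (orbit x) (∈-filter⁺ (outside-orbit? x) y∈S y∉orbit)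
    from : y ∈ orbit x ++ outside-orbit x S → y ∈ S
    from y∈split with ∈-++⁻ (orbit x) y∈split
    ... | inj₁ y∈orbit = orbit-⊆-closed closed x∈S y∈orbit
    ... | inj₂ y∈rest  = proj₁ (∈-outside-orbit⁻ x {S} y∈rest)

  length-orbit-split : ∀ {S} → Unique S → Closed S → ∀ {x} → x ∈ S →
    length S ≡ suc m + length (outside-orbit x S)
  length-orbit-split {S} unique-S closed {x} x∈S = begin
    length S                             ≡⟨ ↭-length S↭split ⟩
    length (orbit x ++ rest)             ≡⟨ length-++ (orbit x) ⟩
    length (orbit x) + length rest       ≡⟨ cong (_+ length rest) (length-applyUpTo (λ j → (α ^ₚ j) ⟨$⟩ʳ x) (suc m)) ⟩
    suc m + length rest                  ∎
    where
    open ≡-Reasoning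
    rest : List (Fin n)
    rest = outside-orbit x S

    unique-split : Unique (orbit x ++ rest)
    unique-split = Unique.++⁺ (orbit-unique x) (outside-orbit-unique x unique-S)
      (λ (y∈orbit , y∈rest) → proj₂ (∈-outside-orbit⁻ x {S} y∈rest) y∈orbit)

    S↭split : S ↭ orbit x ++ rest
    S↭split = ∼bag⇒↭ (unique∧set⇒bag unique-S unique-split (orbit-++-outside-orbit closed x∈S))

  order∣length-closed : ∀ S → Acc _<_ (length S) → Unique S → Closed S → suc m ∣ length S
  order∣length-closed []      _        _        _      = suc m ∣0
  order∣length-closed (x ∷ S) (acc rs) unique-S closed =
    subst (suc m ∣_) (≡.sym split) (∣m∣n⇒∣m+n ∣-refl
      (order∣length-closed (outside-orbit x (x ∷ S)) (rs shorter)
        (outside-orbit-unique x unique-S) (outside-orbit-closed x closed)))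
    where
    split : length (x ∷ S) ≡ suc m + length (outside-orbit x (x ∷ S))
    split = length-orbit-split unique-S closed (here refl)

    shorter : length (outside-orbit x (x ∷ S)) < length (x ∷ S)
    shorter = subst (length (outside-orbit x (x ∷ S)) <_) (≡.sym split) (s≤s (m≤n+m _ m))

  order∣n : suc m ∣ n
  order∣n = subst (suc m ∣_) (length-tabulate _)
    (order∣length-closed (allFin n) (<-wellFounded _) (Unique.allFin⁺ n) (λ {y} _ → ∈-allFin (α ⟨$⟩ʳ y)))

module _ {n : ℕ} (L : LatinSquare n) (L-symmetric : Symmetric L) where

  module Principal (α β : Permutation′ n) (aut : IsPrincipalAutotopism L α β) where

    β∘α≈id : ∀ r → β ⟨$⟩ʳ (α ⟨$⟩ʳ r) ≡ r
    β∘α≈id r = row-inj L (α ⟨$⟩ʳ r) (trans (aut r (α ⟨$⟩ʳ r)) (L-symmetric r (α ⟨$⟩ʳ r)))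

    β≈flipα : β ≈ₚ flip α
    β≈flipα i = trans (cong (β ⟨$⟩ʳ_) (≡.sym (inverseʳ α))) (β∘α≈id (α ⟨$⟩ˡ i))

    transpose : IsPrincipalAutotopism L β α
    transpose c r = trans (L-symmetric _ _) (trans (aut r c) (L-symmetric r c))

    self-adjoint : ∀ r c → sym L (α ⟨$⟩ʳ r) c ≡ sym L r (α ⟨$⟩ʳ c)
    self-adjoint r c = trans (cong (sym L (α ⟨$⟩ʳ r)) (≡.sym (β∘α≈id c))) (aut r (α ⟨$⟩ʳ c))

    ^ₚ-self-adjoint : ∀ j r c → sym L ((α ^ₚ j) ⟨$⟩ʳ r) c ≡ sym L r ((α ^ₚ j) ⟨$⟩ʳ c)
    ^ₚ-self-adjoint zero    r c = refl
    ^ₚ-self-adjoint (suc j) r c = begin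
      sym L ((α ^ₚ j) ⟨$⟩ʳ (α ⟨$⟩ʳ r)) c ≡⟨ ^ₚ-self-adjoint j (α ⟨$⟩ʳ r) c ⟩
      sym L (α ⟨$⟩ʳ r) ((α ^ₚ j) ⟨$⟩ʳ c) ≡⟨ self-adjoint r ((α ^ₚ j) ⟨$⟩ʳ c) ⟩
      sym L r (α ⟨$⟩ʳ ((α ^ₚ j) ⟨$⟩ʳ c)) ≡⟨ cong (sym L r) (≡.sym (^ₚ-suc α j c)) ⟩
      sym L r ((α ^ₚ suc j) ⟨$⟩ʳ c)      ∎
      where open ≡-Reasoning

    fixed-point⇒^ₚ≈id : ∀ d r → (α ^ₚ d) ⟨$⟩ʳ r ≡ r → (α ^ₚ d) ≈ₚ id
    fixed-point⇒^ₚ≈id d r αᵈr≡r c = row-inj L r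
      (trans (≡.sym (^ₚ-self-adjoint d r c)) (cong (λ r′ → sym L r′ c) αᵈr≡r))

    order∣n : ∀ k → IsOrder α k → k ∣ n
    order∣n (suc m) (_ , α^k≈id , minimal) = Semiregular.order∣n α α^k≈id
      (λ d r 0<d d<k αᵈr≡r → minimal d 0<d d<k (fixed-point⇒^ₚ≈id d r αᵈr≡r))

  principal-comm : ∀ α β α′ β′ → IsPrincipalAutotopism L α β → IsPrincipalAutotopism L α′ β′ →
    (α ∘ₚ α′) ≈ₚ (α′ ∘ₚ α)
  principal-comm α β α′ β′ aut aut′ c = col-inj L c (begin
    sym L (α′ ⟨$⟩ʳ (α ⟨$⟩ʳ c)) c ≡⟨ Principal.self-adjoint α′ β′ aut′ (α ⟨$⟩ʳ c) c ⟩
    sym L (α ⟨$⟩ʳ c) (α′ ⟨$⟩ʳ c) ≡⟨ L-symmetric (α ⟨$⟩ʳ c) (α′ ⟨$⟩ʳ c) ⟩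
    sym L (α′ ⟨$⟩ʳ c) (α ⟨$⟩ʳ c) ≡⟨ ≡.sym (Principal.self-adjoint α β aut (α′ ⟨$⟩ʳ c) c) ⟩
    sym L (α ⟨$⟩ʳ (α′ ⟨$⟩ʳ c)) c ∎)
    where open ≡-Reasoning

lemma14 : (n : ℕ) (L : LatinSquare n) → Symmetric L →
    ((α β α′ β′ : Permutation′ n) →
      IsPrincipalAutotopism L α β → IsPrincipalAutotopism L α′ β′ →
      ((α ∘ₚ α′) ≈ₚ (α′ ∘ₚ α)) × ((β ∘ₚ β′) ≈ₚ (β′ ∘ₚ β)))
    × ((α β : Permutation′ n) → IsPrincipalAutotopism L α β →
      (β ≈ₚ flip α) × ((k : ℕ) → IsOrder α k → k ∣ n))
lemma14 n L L-symmetric =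
    (λ α β α′ β′ aut aut′ →
        principal-comm L L-symmetric α β α′ β′ aut aut′
      , principal-comm L L-symmetric β α β′ α′ (transpose α β aut) (transpose α′ β′ aut′))
  , (λ α β aut → β≈flipα α β aut , order∣n α β aut)
  where open Principal L L-symmetric
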